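{- Let $Q$ be a key with vertices $\{k,k'\}$ in which neither $k$ nor $k'$ is a sink or a source. Let $P=\mu_k(Q)$ and $P'=\mu_{k'}(Q)$. Then: (1) $|P_1|>|Q_1|$ and $|P'_1|>|Q_1|$; (2) $P\setminus\{k'\}$ and $P'\setminus\{k\}$ are forks with points of return $k$ and $k'$ respectively; (3) $P\setminus\{k\}$ and $P'\setminus\{k'\}$ are abundant acyclic quivers; (4) $P^k_{k'}=(P')^k_{k'}=P_0\setminus\{k,k'\}$ as sets; (5) for every vertex $r\neq k,k'$, both $\mu_r(P)$ and $\mu_r(P')$ are forks with point of return $r$.
   Context: A quiver is a finite directed multigraph with vertex set $Q_0$ and arrow set $Q_1$, no loops and no 2-cycles; $|Q_1|$ is the total number of arrows; $q_{ij}$ is the number of arrows $i\to j$ if positive and minus the number of arrows $j\to i$ otherwise. Mutation $\mu_v$: $q'_{ab}=-q_{ab}$ if $v\in\{a,b\}$, else $q'_{ab}=q_{ab}+\max(q_{av},0)\max(q_{vb},0)-\max(q_{bv},0)\max(q_{va},0)$. $Q\setminus V$ is the full subquiver on the vertices not in $V$. $Q^+(v)=\{j:q_{vj}>0\}$, $Q^-(v)=\{j:q_{jv}>0\}$, and $Q^k_{k'}=(Q^+(k)\cap Q^-(k'))\cup(Q^+(k')\cap Q^-(k))$. Abundant: at least two arrows between every pair of distinct vertices; acyclic: no directed cycle; source (sink): only outgoing (incoming) arrows. A fork is an abundant, non-acyclic quiver $F$ with a vertex $r$ (point of return) such that for all $i\in F^-(r)$, $j\in F^+(r)$: $f_{ji}>f_{ir}$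 and $f_{ji}>f_{rj}$, and the full subquivers on $F^-(r)$, $F^+(r)$ are acyclic. A key with vertices $\{k,k'\}$ ($k\ne k'$) is a quiver $Q$ with $Q\setminus\{k\}$ and $Q\setminus\{k'\}$ abundant acyclic and such that for each vertex $i\notin\{k,k'\}$ either ($k\to i$ and $k'\to i$) or ($i\to k$ and $i\to k'$); any number (possibly zero) of arrows between $k$ and $k'$. -}

module Defs where

open import Data.Nat as ℕ using (ℕ)
open import Data.Integer using (ℤ; +_; -[1+_]; -_; _+_; _-_; _*_; _<_; ∣_∣)
open import Data.Fin using (Fin; _≟_)
open import Data.List using (map; allFin)
open import Data.Nat.ListAction using (sum)
open import Data.Product using (_×_)
open import Data.Sum using (_⊎_)
open import Data.Unit using (⊤)
open import Relation.Nullary using (¬_; yes; no)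
open import Relation.Binary.PropositionalEquality using (_≡_; _≢_)

-- A quiver on vertex set Fin n is encoded by its exchange matrix q (q i j = q_{ij}).
Mat : ℕ → Set
Mat n = Fin n → Fin n → ℤ

-- skew-symmetry: no 2-cycles and (with i = j) no loops
IsQuiver : ∀ {n} → Mat n → Set
IsQuiver q = ∀ i j → q i j ≡ - q j i

pos : ℤ → ℕ
pos (+ m) = m
pos -[1+ m ] = 0

[_]⁺ : ℤ → ℤ
[ x ]⁺ = + pos x

μ : ∀ {n} → Fin n → Mat n → Mat n
μ v q a b with a ≟ v | b ≟ v
... | yes _ | _ = - q a b
... | no _ | yes _ = - q a b
... | no _ | no _ = q a b + [ q a v ]⁺ * [ q v b ]⁺ - [ q b v ]⁺ * [ q v a ]⁺

arrows : ∀ {n} → Mat n → ℕ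
arrows {n} q = sum (map (λ i → sum (map (λ j → pos (q i j)) (allFin n))) (allFin n))

-- vertex sets (full subquivers are described by their vertex set)
VSet : ℕ → Set₁
VSet n = Fin n → Set

allV : ∀ {n} → VSet n
allV _ = ⊤

without : ∀ {n} → Fin n → VSet n
without v i = i ≢ v

Out : ∀ {n} → Mat n → Fin n → Fin n → Set
Out q v j = + 0 < q v j

In : ∀ {n} → Mat n → Fin n → Fin n → Set
In q v j = + 0 < q j v

Arrow : ∀ {n} → Mat n → VSet n → Fin n → Fin n → Set
Arrow q S i j = S i × S j × (+ 0 < q i j)

data Path {n} (q : Mat n) (S : VSet n) : Fin n → Fin n → Set where
  edge : ∀ {i j} → Arrow q S i j → Path q S i j
  _∷_  : ∀ {i j l} → Arrow q S i j → Path q S j l → Path q S i l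

Acyclic : ∀ {n} → Mat n → VSet n → Set
Acyclic q S = ∀ i → ¬ Path q S i i

Abundant : ∀ {n} → Mat n → VSet n → Set
Abundant q S = ∀ i j → S i → S j → i ≢ j → 2 ℕ.≤ ∣ q i j ∣

IsSource : ∀ {n} → Mat n → Fin n → Set
IsSource q v = ∀ j → ¬ In q v j

IsSink : ∀ {n} → Mat n → Fin n → Set
IsSink q v = ∀ j → ¬ Out q v j

IsFork : ∀ {n} → Mat n → VSet n → Fin n → Set
IsFork q S r =
  S r × Abundant q S × ¬ Acyclic q S
  × (∀ i j → S i → S j → In q r i → Out q r j → (q i r < q j i) × (q r j < q j i))
  × Acyclic q (λ i → S i × In q r i)
  × Acyclic q (λ j → S j × Out q r j)

IsKey : ∀ {n} → Mat n → Fin n → Fin n → Set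
IsKey q k k' =
  k ≢ k'
  × Abundant q (without k) × Acyclic q (without k)
  × Abundant q (without k') × Acyclic q (without k')
  × (∀ i → i ≢ k → i ≢ k' → (Out q k i × Out q k' i) ⊎ (In q k i × In q k' i))

Between : ∀ {n} → Mat n → Fin n → Fin n → Fin n → Set
Between q k k' i = (Out q k i × In q k' i) ⊎ (Out q k' i × In q k i)

-- In a key a path a → k → b already forces a → b, so μ_k only strengthens
-- the arrows of Q \ {k}, and strictly so along a path through k: this gives (1), (3), (4).
-- Conversely μ_v yields a fork returning at v as soon as the quiver is abundant around v,
-- the in- and out-neighbourhoods of v are acyclic and every new entry q_{yx} + q_{yv} q_{vx}
-- exceeds q_{yv} and q_{vx}.  For (2) this is checked on Q \ {k'} at v = k; for (5) on μ_k Q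
-- at v = r, where r separates k from k' and a triangle y → r → x → y can only run through k,
-- whose reversed arrows are estimated directly.  Everything is symmetric in k and k'.

module Submission where

open import Data.Nat as ℕ using (ℕ; suc; z≤n; s≤s; _<_)
import Data.Nat.Properties as ℕP
open import Algebra.Properties.CommutativeSemigroup ℕP.+-commutativeSemigroup
  using () renaming (interchange to +-interchange)
open import Data.Integer using (ℤ; +_; -[1+_]; -_; _+_; _-_; _*_; ∣_∣; +<+; +≤+)
  renaming (_<_ to _<ℤ_; _≤_ to _≤ℤ_)
import Data.Integer.Properties as ℤP
open import Data.Integer.Tactic.RingSolver using (solve-∀)
open import Data.Fin using (Fin; _≟_)
open import Data.Fin.Properties using (any?)
open import Data.List using (List; []; _∷_; map; allFin)
import Data.List.Properties as ListP
open import Data.List.Membership.Propositional using (_∈_)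
open import Data.List.Membership.Propositional.Properties using (∈-allFin)
open import Data.List.Relation.Unary.Any using (here; there)
open import Data.Nat.ListAction using (sum)
open import Data.Product as Product using (_×_; _,_; proj₁; proj₂; ∃)
open import Data.Sum as Sum using (_⊎_; inj₁; inj₂)
open import Data.Empty using (⊥-elim)
open import Data.Unit using (⊤; tt)
open import Relation.Nullary using (¬_; yes; no)
open import Relation.Nullary.Decidable using (toSum)
open import Relation.Binary.PropositionalEquality
open import Function.Bundles using (_⇔_; mk⇔; Equivalence)
import Function.Properties.Equivalence as ⇔

open import Defs

Pos : ℤ → Set
Pos x = + 0 <ℤ x

Pos-suc : ∀ {m} → Pos (+ suc m)
Pos-suc = +<+ (s≤s z≤n)

Pos⇒¬Pos-neg : ∀ {x} → Pos x → ¬ Pos (- x)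
Pos⇒¬Pos-neg {+ suc m} (+<+ _) ()

Pos⇒≢0 : ∀ {x} → Pos x → x ≢ + 0
Pos⇒≢0 (+<+ ()) refl

Pos-trichotomy : ∀ x → Pos x ⊎ x ≡ + 0 ⊎ Pos (- x)
Pos-trichotomy (+ ℕ.zero) = inj₂ (inj₁ refl)
Pos-trichotomy (+ suc m)  = inj₁ Pos-suc
Pos-trichotomy -[1+ m ]   = inj₂ (inj₂ Pos-suc)

[]⁺-of-¬Pos : ∀ {x} → ¬ Pos x → [ x ]⁺ ≡ + 0
[]⁺-of-¬Pos {+ ℕ.zero} _ = refl
[]⁺-of-¬Pos {+ suc m}  ¬p = ⊥-elim (¬p Pos-suc)
[]⁺-of-¬Pos { -[1+ m ]} _ = refl

[]⁺-of-Pos : ∀ {x} → Pos x → [ x ]⁺ ≡ x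
[]⁺-of-Pos {+ suc m}    _        = refl
[]⁺-of-Pos {+ ℕ.zero} (+<+ ())

[]⁺*[]⁺≡0 : ∀ x y → ¬ (Pos x × Pos y) → [ x ]⁺ * [ y ]⁺ ≡ + 0
[]⁺*[]⁺≡0 x y ¬both with + 0 ℤP.<? x | + 0 ℤP.<? y
... | yes px | yes py = ⊥-elim (¬both (px , py))
... | no ¬px | _      = cong (_* [ y ]⁺) ([]⁺-of-¬Pos ¬px)
... | yes _  | no ¬py = trans (cong ([ x ]⁺ *_) ([]⁺-of-¬Pos ¬py)) (ℤP.*-zeroʳ [ x ]⁺)

[]⁺*[]⁺≡* : ∀ {x y} → Pos x → Pos y → [ x ]⁺ * [ y ]⁺ ≡ x * y
[]⁺*[]⁺≡* px py = cong₂ _*_ ([]⁺-of-Pos px) ([]⁺-of-Pos py)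

x≤x+[]⁺*[]⁺ : ∀ z x y → z ≤ℤ z + [ x ]⁺ * [ y ]⁺
x≤x+[]⁺*[]⁺ z x y =
  subst (λ w → z ≤ℤ z + w) (ℤP.pos-* (pos x) (pos y)) (ℤP.i≤i+j z (+ (pos x ℕ.* pos y)))

2≤∣x∣⇒x≢0 : ∀ {x} → 2 ℕ.≤ ∣ x ∣ → x ≢ + 0
2≤∣x∣⇒x≢0 () refl

2≤∣x∣⇒Pos⇒2≤x : ∀ {x} → 2 ℕ.≤ ∣ x ∣ → Pos x → + 2 ≤ℤ x
2≤∣x∣⇒Pos⇒2≤x {+ m} h _ = +≤+ h

2≤x⇒2≤∣x∣ : ∀ {x} → + 2 ≤ℤ x → 2 ℕ.≤ ∣ x ∣
2≤x⇒2≤∣x∣ (+≤+ h) = h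

∣∣-mono-≤ : ∀ {x y} → + 0 ≤ℤ x → x ≤ℤ y → ∣ x ∣ ℕ.≤ ∣ y ∣
∣∣-mono-≤ (+≤+ _) (+≤+ h) = h

∣x∣<∣x+y*z∣ : ∀ {x y z} → + 0 ≤ℤ x → Pos y → Pos z → ∣ x ∣ ℕ.< ∣ x + y * z ∣
∣x∣<∣x+y*z∣ {+ a} {+ suc _}  {+ suc _}  _ _        _        = ℕP.m<m+n a (s≤s z≤n)
∣x∣<∣x+y*z∣ {+ a} {+ ℕ.zero} {_}        _ (+<+ ()) _
∣x∣<∣x+y*z∣ {+ a} {+ suc _}  {+ ℕ.zero} _ _        (+<+ ())

n<d+m*n : ∀ d {m n} → 2 ℕ.≤ m → 1 ℕ.≤ n → n ℕ.< d ℕ.+ m ℕ.* n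
n<d+m*n d {m} {n@(suc _)} 2≤m _ =
  ℕP.<-≤-trans (subst (n ℕ.<_) (ℕP.*-comm n m) (ℕP.m<m*n n m 2≤m)) (ℕP.m≤n+m (m ℕ.* n) d)

-- The fork inequalities f_{ji} > f_{ir}, f_{rj} when mutation at r creates
-- f_{ji} = d + f_{rj} f_{ir} with d ≥ 0.
fork-ineq : ∀ {d u v} → + 0 ≤ℤ d → + 2 ≤ℤ u → + 2 ≤ℤ v →
            (v <ℤ d + u * v) × (u <ℤ d + u * v)
fork-ineq {+ d} {+ u} {+ v} _ (+≤+ 2≤u) (+≤+ 2≤v) rewrite sym (ℤP.pos-* u v) =
  +<+ (n<d+m*n d 2≤u (ℕP.≤-trans (s≤s z≤n) 2≤v)) ,
  +<+ (subst (λ w → u ℕ.< d ℕ.+ w) (ℕP.*-comm v u) (n<d+m*n d 2≤v (ℕP.≤-trans (s≤s z≤n) 2≤u)))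

-ˡ-< : ∀ x {y z} → x + y <ℤ z → y <ℤ - x + z
-ˡ-< x {y} {z} h = subst (_<ℤ - x + z) (-x+[x+y]≡y x y) (ℤP.+-monoʳ-< (- x) h)
  where
  -x+[x+y]≡y : ∀ x y → - x + (x + y) ≡ y
  -x+[x+y]≡y = solve-∀

a+b<e*b∧a+e<e*b : ∀ a b d → 1 ℕ.≤ a → 2 ℕ.≤ b →
  let e = d ℕ.+ a ℕ.* b in (a ℕ.+ b ℕ.< e ℕ.* b) × (a ℕ.+ e ℕ.< e ℕ.* b)
a+b<e*b∧a+e<e*b a@(suc _) b d _ 2≤b =
  ℕP.<-≤-trans (ℕP.+-mono-<-≤ a<e b≤e) e+e≤e*b , ℕP.<-≤-trans (ℕP.+-monoˡ-< e a<e) e+e≤e*b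
  where
  e = d ℕ.+ a ℕ.* b
  a<e : a ℕ.< e
  a<e = ℕP.<-≤-trans (ℕP.m<m*n a b 2≤b) (ℕP.m≤n+m (a ℕ.* b) d)
  b≤e : b ℕ.≤ e
  b≤e = ℕP.≤-trans (ℕP.m≤n*m b a) (ℕP.m≤n+m (a ℕ.* b) d)
  e+e≤e*b : e ℕ.+ e ℕ.≤ e ℕ.* b
  e+e≤e*b = subst (ℕ._≤ e ℕ.* b) (trans (ℕP.*-comm e 2) (cong (e ℕ.+_) (ℕP.+-identityʳ e)))
                  (ℕP.*-monoʳ-≤ e 2≤b)

-- Two mutations in a row: the first reverses an arrow of weight a and creates an entry
-- d + a b, the second then creates -a + (d + a b) b.
fork-ineq-reversed : ∀ {a b d} → Pos a → + 2 ≤ℤ b → + 0 ≤ℤ d →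
  (b <ℤ - a + (d + a * b) * b) × (d + a * b <ℤ - a + (d + a * b) * b)
fork-ineq-reversed {+ a@(suc _)} {+ b} {+ d} _ (+≤+ 2≤b) _
  rewrite sym (ℤP.pos-* a b) | sym (ℤP.pos-* (d ℕ.+ a ℕ.* b) b) =
  Product.map (λ h → -ˡ-< (+ a) (+<+ h)) (λ h → -ˡ-< (+ a) (+<+ h))
              (a+b<e*b∧a+e<e*b a b d (s≤s z≤n) 2≤b)
fork-ineq-reversed {+ ℕ.zero} (+<+ ())

module _ {n} {q : Mat n} where

  Path-map : ∀ {q' : Mat n} {S S' : VSet n} → (∀ {a b} → Arrow q S a b → Arrow q' S' a b) →
             ∀ {i j} → Path q S i j → Path q' S' i j
  Path-map f (edge a)   = edge (f a)
  Path-map f (a ∷ path) = f a ∷ Path-map f path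

  Acyclic-map : ∀ {q' : Mat n} {S S' : VSet n} → (∀ {a b} → Arrow q S a b → Arrow q' S' a b) →
                Acyclic q' S' → Acyclic q S
  Acyclic-map f acyclic i cycle = acyclic i (Path-map f cycle)

  Acyclic-mono : ∀ {S S' : VSet n} → (∀ {i} → S i → S' i) → Acyclic q S' → Acyclic q S
  Acyclic-mono S⊆S' = Acyclic-map (λ (Sa , Sb , p) → S⊆S' Sa , S⊆S' Sb , p)

  Acyclic-adjoin-sink : ∀ {T T' : VSet n} k → (∀ x → T x → x ≢ k → T' x) →
                        (∀ x → T x → ¬ Pos (q k x)) → Acyclic q T' → Acyclic q T
  Acyclic-adjoin-sink {T} {T'} k T⊆T'+k sink acyclic i cycle =
    acyclic i (lift cycle (start≢k cycle))
    where
    start≢k : ∀ {i j} → Path q T i j → i ≢ k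
    start≢k (edge (_ , Tj , p)) refl = sink _ Tj p
    start≢k ((_ , Tj , p) ∷ _)  refl = sink _ Tj p

    lift : ∀ {i j} → Path q T i j → j ≢ k → Path q T' i j
    lift path@(edge (Ti , Tj , p)) j≢k =
      edge (T⊆T'+k _ Ti (start≢k path) , T⊆T'+k _ Tj j≢k , p)
    lift path@((Ti , Tm , p) ∷ rest) j≢k =
      (T⊆T'+k _ Ti (start≢k path) , T⊆T'+k _ Tm (start≢k rest) , p) ∷ lift rest j≢k

  Acyclic-adjoin-source : ∀ {T T' : VSet n} k → (∀ x → T x → x ≢ k → T' x) →
                          (∀ x → T x → ¬ Pos (q x k)) → Acyclic q T' → Acyclic q T
  Acyclic-adjoin-source {T} {T'} k T⊆T'+k source acyclic i cycle =
    acyclic i (lift cycle (end≢k cycle))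
    where
    end≢k : ∀ {i j} → Path q T i j → j ≢ k
    end≢k (edge (Ti , _ , p)) refl = source _ Ti p
    end≢k (_ ∷ rest)               = end≢k rest

    target≢k : ∀ {i j} → Arrow q T i j → j ≢ k
    target≢k (Ti , _ , p) refl = source _ Ti p

    lift : ∀ {i j} → Path q T i j → i ≢ k → Path q T' i j
    lift (edge a@(Ti , Tj , p)) i≢k = edge (T⊆T'+k _ Ti i≢k , T⊆T'+k _ Tj (target≢k a) , p)
    lift (a@(Ti , Tm , p) ∷ rest) i≢k =
      (T⊆T'+k _ Ti i≢k , T⊆T'+k _ Tm (target≢k a) , p) ∷ lift rest (target≢k a)

module Quiver {n} (q : Mat n) (skew : IsQuiver q) where

  no-2-cycle : ∀ {a b} → Pos (q a b) → ¬ Pos (q b a)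
  no-2-cycle {a} {b} p p' = Pos⇒¬Pos-neg p (subst Pos (skew b a) p')

  no-loop : ∀ {a} → ¬ Pos (q a a)
  no-loop p = no-2-cycle p p

  arrow⇒≢ : ∀ {a b} → Pos (q a b) → a ≢ b
  arrow⇒≢ p refl = no-loop p

  trichotomy : ∀ a b → Pos (q a b) ⊎ q a b ≡ + 0 ⊎ Pos (q b a)
  trichotomy a b with Pos-trichotomy (q a b)
  ... | inj₁ p          = inj₁ p
  ... | inj₂ (inj₁ e)   = inj₂ (inj₁ e)
  ... | inj₂ (inj₂ p)   = inj₂ (inj₂ (subst Pos (sym (skew b a)) p))

  ∣∣-sym : ∀ a b → ∣ q a b ∣ ≡ ∣ q b a ∣
  ∣∣-sym a b rewrite skew a b = ℤP.∣-i∣≡∣i∣ (q b a)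

  abundant⇒arrow : ∀ {a b} → 2 ℕ.≤ ∣ q a b ∣ → Pos (q a b) ⊎ Pos (q b a)
  abundant⇒arrow {a} {b} h with trichotomy a b
  ... | inj₁ p        = inj₁ p
  ... | inj₂ (inj₁ e) = ⊥-elim (2≤∣x∣⇒x≢0 h e)
  ... | inj₂ (inj₂ p) = inj₂ p

¬Source⇒In : ∀ {n} (q : Mat n) v → ¬ IsSource q v → ∃ λ j → In q v j
¬Source⇒In q v ¬src with any? (λ j → + 0 ℤP.<? q j v)
... | yes w  = w
... | no ¬w  = ⊥-elim (¬src (λ j p → ¬w (j , p)))

¬Sink⇒Out : ∀ {n} (q : Mat n) v → ¬ IsSink q v → ∃ λ j → Out q v j
¬Sink⇒Out q v ¬snk with any? (λ j → + 0 ℤP.<? q v j)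
... | yes w  = w
... | no ¬w  = ⊥-elim (¬snk (λ j p → ¬w (j , p)))

module Mutation {n} (q : Mat n) where

  μ-row : ∀ v b → μ v q v b ≡ - q v b
  μ-row v b with v ≟ v
  ... | yes _ = refl
  ... | no v≢v = ⊥-elim (v≢v refl)

  μ-col : ∀ v a → μ v q a v ≡ - q a v
  μ-col v a with a ≟ v | v ≟ v
  ... | yes _ | _      = refl
  ... | no _  | yes _  = refl
  ... | no _  | no v≢v = ⊥-elim (v≢v refl)

  μ-off : ∀ {v a b} → a ≢ v → b ≢ v →
          μ v q a b ≡ q a b + [ q a v ]⁺ * [ q v b ]⁺ - [ q b v ]⁺ * [ q v a ]⁺
  μ-off {v} {a} {b} a≢v b≢v with a ≟ v | b ≟ v
  ... | yes a≡v | _       = ⊥-elim (a≢v a≡v)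
  ... | no _    | yes b≡v = ⊥-elim (b≢v b≡v)
  ... | no _    | no _    = refl

  μ-no-return : ∀ {v a b} → a ≢ v → b ≢ v → ¬ (Pos (q b v) × Pos (q v a)) →
                μ v q a b ≡ q a b + [ q a v ]⁺ * [ q v b ]⁺
  μ-no-return {v} {a} {b} a≢v b≢v ¬ret = begin
    μ v q a b                               ≡⟨ μ-off a≢v b≢v ⟩
    through - [ q b v ]⁺ * [ q v a ]⁺       ≡⟨ cong (_-_ through) ([]⁺*[]⁺≡0 _ _ ¬ret) ⟩
    through + + 0                           ≡⟨ ℤP.+-identityʳ through ⟩
    through                                 ∎
    where
    open ≡-Reasoning
    through : ℤ
    through = q a b + [ q a v ]⁺ * [ q v b ]⁺

  μ-unchanged : ∀ {v a b} → a ≢ v → b ≢ v → ¬ (Pos (q a v) × Pos (q v b)) →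
                ¬ (Pos (q b v) × Pos (q v a)) → μ v q a b ≡ q a b
  μ-unchanged a≢v b≢v ¬through ¬ret =
    trans (μ-no-return a≢v b≢v ¬ret)
          (trans (cong (_+_ (q _ _)) ([]⁺*[]⁺≡0 _ _ ¬through)) (ℤP.+-identityʳ _))

  μ-skew : IsQuiver q → ∀ v → IsQuiver (μ v q)
  μ-skew skew v a b with toSum (a ≟ v) | toSum (b ≟ v)
  ... | inj₁ refl | _ rewrite μ-row a b | μ-col a b = cong -_ (skew a b)
  ... | inj₂ _ | inj₁ refl rewrite μ-row b a | μ-col b a = cong -_ (skew a b)
  ... | inj₂ a≢v | inj₂ b≢v rewrite μ-off a≢v b≢v | μ-off b≢v a≢v | skew a b =
    -z+x-y≡-[z+y-x] (q b a) ([ q a v ]⁺ * [ q v b ]⁺) ([ q b v ]⁺ * [ q v a ]⁺)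
    where
    -z+x-y≡-[z+y-x] : ∀ z x y → - z + x - y ≡ - (z + y - x)
    -z+x-y≡-[z+y-x] = solve-∀

module MutationAt {n} (q : Mat n) (skew : IsQuiver q) (v : Fin n) where
  open Quiver q skew
  open Mutation q

  μ-row≡col : ∀ j → μ v q v j ≡ q j v
  μ-row≡col j = trans (μ-row v j) (sym (skew j v))

  μ-col≡row : ∀ i → μ v q i v ≡ q v i
  μ-col≡row i = trans (μ-col v i) (sym (skew v i))

  μ-In⇒Out : ∀ {i} → In (μ v q) v i → Out q v i
  μ-In⇒Out {i} = subst Pos (μ-col≡row i)

  μ-Out⇒In : ∀ {i} → Out (μ v q) v i → In q v i
  μ-Out⇒In {i} = subst Pos (μ-row≡col i)

  In≢ : ∀ {a} → In q v a → a ≢ v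
  In≢ = arrow⇒≢

  Out≢ : ∀ {a} → Out q v a → a ≢ v
  Out≢ p e = arrow⇒≢ p (sym e)

  μ-through : ∀ {a b} → In q v a → Out q v b → μ v q a b ≡ q a b + q a v * q v b
  μ-through ia ob = trans (μ-no-return (In≢ ia) (Out≢ ob) (λ (_ , ova) → no-2-cycle ia ova))
                          (cong (_+_ (q _ _)) ([]⁺*[]⁺≡* ia ob))

  μ-within-In : ∀ {a b} → In q v a → In q v b → μ v q a b ≡ q a b
  μ-within-In ia ib = μ-unchanged (In≢ ia) (In≢ ib) (λ (_ , ovb) → no-2-cycle ib ovb)
                                                   (λ (_ , ova) → no-2-cycle ia ova)

  μ-within-Out : ∀ {a b} → Out q v a → Out q v b → μ v q a b ≡ q a b
  μ-within-Out oa ob = μ-unchanged (Out≢ oa) (Out≢ ob) (λ (iva , _) → no-2-cycle oa iva)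
                                                      (λ (ivb , _) → no-2-cycle ob ivb)

  -- Mutation at v swaps the in- and out-neighbourhoods of v and keeps the arrows inside each.
  μ-fork : ∀ {S : VSet n} → S v
    → (∀ x → S x → x ≢ v → 2 ℕ.≤ ∣ q v x ∣)
    → (∀ a b → S a → S b → a ≢ b → (In q v a × In q v b) ⊎ (Out q v a × Out q v b) →
         2 ℕ.≤ ∣ q a b ∣)
    → (∀ y x → S y → S x → In q v y → Out q v x →
         (q v x <ℤ q y x + q y v * q v x) × (q y v <ℤ q y x + q y v * q v x))
    → Acyclic q (λ i → S i × In q v i)
    → Acyclic q (λ i → S i × Out q v i)
    → (∃ λ y → ∃ λ x → S y × S x × In q v y × Out q v x)
    → IsFork (μ v q) S v
  μ-fork {S} Sv abundant-at-v abundant-sides dominates acyclic-In acyclic-Out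
         (y₀ , x₀ , Sy₀ , Sx₀ , iy₀ , ox₀) =
    Sv , abundant , ¬acyclic , returns , acyclic-Inᵛ , acyclic-Outᵛ
    where
    module R = Quiver (μ v q) (μ-skew skew v)

    side : ∀ x → S x → x ≢ v → In q v x ⊎ Out q v x
    side x Sx x≢v = Sum.swap (abundant⇒arrow (abundant-at-v x Sx x≢v))

    through-dominates : ∀ {y x} → S y → S x → In q v y → Out q v x → q v x <ℤ μ v q y x
    through-dominates Sy Sx iy ox =
      subst (_ <ℤ_) (sym (μ-through iy ox)) (proj₁ (dominates _ _ Sy Sx iy ox))

    2≤through : ∀ {y x} → S y → S x → In q v y → Out q v x → 2 ℕ.≤ ∣ μ v q y x ∣
    2≤through {x = x} Sy Sx iy ox = 2≤x⇒2≤∣x∣ (ℤP.<⇒≤ (ℤP.≤-<-trans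
      (2≤∣x∣⇒Pos⇒2≤x (abundant-at-v x Sx (Out≢ ox)) ox) (through-dominates Sy Sx iy ox)))

    abundant : Abundant (μ v q) S
    abundant a b Sa Sb a≢b with toSum (a ≟ v) | toSum (b ≟ v)
    ... | inj₁ refl | _ rewrite μ-row a b | ℤP.∣-i∣≡∣i∣ (q a b) =
      abundant-at-v b Sb (λ e → a≢b (sym e))
    ... | inj₂ _ | inj₁ refl rewrite μ-col b a | ℤP.∣-i∣≡∣i∣ (q a b) | ∣∣-sym a b =
      abundant-at-v a Sa a≢b
    ... | inj₂ a≢v | inj₂ b≢v with side a Sa a≢v | side b Sb b≢v
    ...   | inj₁ ia | inj₁ ib rewrite μ-within-In ia ib  = abundant-sides a b Sa Sb a≢b (inj₁ (ia , ib))
    ...   | inj₂ oa | inj₂ ob rewrite μ-within-Out oa ob = abundant-sides a b Sa Sb a≢b (inj₂ (oa , ob))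
    ...   | inj₁ ia | inj₂ ob = 2≤through Sa Sb ia ob
    ...   | inj₂ oa | inj₁ ib rewrite R.∣∣-sym a b = 2≤through Sb Sa ib oa

    ¬acyclic : ¬ Acyclic (μ v q) S
    ¬acyclic acyclic = acyclic v
      ( (Sv , Sy₀ , subst Pos (sym (μ-row≡col y₀)) iy₀)
      ∷ (Sy₀ , Sx₀ , ℤP.<-trans ox₀ (through-dominates Sy₀ Sx₀ iy₀ ox₀))
      ∷ edge (Sx₀ , Sv , subst Pos (sym (μ-col≡row x₀)) ox₀))

    returns : ∀ i j → S i → S j → In (μ v q) v i → Out (μ v q) v j →
              (μ v q i v <ℤ μ v q j i) × (μ v q v j <ℤ μ v q j i)
    returns i j Si Sj ivi ovj = subst₂ (λ a b → (a <ℤ μ v q j i) × (b <ℤ μ v q j i))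
      (sym (μ-col≡row i)) (sym (μ-row≡col j))
      (subst (λ c → (q v i <ℤ c) × (q j v <ℤ c)) (sym (μ-through (μ-Out⇒In ovj) (μ-In⇒Out ivi)))
        (dominates j i Sj Si (μ-Out⇒In ovj) (μ-In⇒Out ivi)))

    acyclic-Inᵛ : Acyclic (μ v q) (λ i → S i × In (μ v q) v i)
    acyclic-Inᵛ = Acyclic-map (λ ((Sa , ia) , (Sb , ib) , p) →
      (Sa , μ-In⇒Out ia) , (Sb , μ-In⇒Out ib) ,
      subst Pos (μ-within-Out (μ-In⇒Out ia) (μ-In⇒Out ib)) p) acyclic-Out

    acyclic-Outᵛ : Acyclic (μ v q) (λ i → S i × Out (μ v q) v i)
    acyclic-Outᵛ = Acyclic-map (λ ((Sa , oa) , (Sb , ob) , p) →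
      (Sa , μ-Out⇒In oa) , (Sb , μ-Out⇒In ob) ,
      subst Pos (μ-within-In (μ-Out⇒In oa) (μ-Out⇒In ob)) p) acyclic-In

module _ {A : Set} where

  sum-map-+ : ∀ (f g : A → ℕ) xs →
              sum (map (λ x → f x ℕ.+ g x) xs) ≡ sum (map f xs) ℕ.+ sum (map g xs)
  sum-map-+ f g []       = refl
  sum-map-+ f g (x ∷ xs) rewrite sum-map-+ f g xs =
    +-interchange (f x) (g x) (sum (map f xs)) (sum (map g xs))

  sum-map-0 : ∀ (xs : List A) → sum (map (λ _ → 0) xs) ≡ 0
  sum-map-0 []       = refl
  sum-map-0 (_ ∷ xs) = sum-map-0 xs

  sum-map-mono-≤ : ∀ {f g : A → ℕ} → (∀ x → f x ℕ.≤ g x) → ∀ xs →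
                   sum (map f xs) ℕ.≤ sum (map g xs)
  sum-map-mono-≤ f≤g []       = z≤n
  sum-map-mono-≤ f≤g (x ∷ xs) = ℕP.+-mono-≤ (f≤g x) (sum-map-mono-≤ f≤g xs)

  sum-map-mono-< : ∀ {f g : A → ℕ} → (∀ x → f x ℕ.≤ g x) → ∀ {x₀ xs} → x₀ ∈ xs →
                   f x₀ ℕ.< g x₀ → sum (map f xs) ℕ.< sum (map g xs)
  sum-map-mono-< f≤g {xs = x ∷ xs} (here refl)   f<g =
    ℕP.+-mono-<-≤ f<g (sum-map-mono-≤ f≤g xs)
  sum-map-mono-< f≤g {xs = x ∷ xs} (there x₀∈xs) f<g =
    ℕP.+-mono-≤-< (f≤g x) (sum-map-mono-< f≤g x₀∈xs f<g)

sum-map-swap : ∀ {A B : Set} (f : A → B → ℕ) xs ys →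
               sum (map (λ x → sum (map (f x) ys)) xs) ≡
               sum (map (λ y → sum (map (λ x → f x y) xs)) ys)
sum-map-swap f []       ys = sym (sum-map-0 ys)
sum-map-swap f (x ∷ xs) ys rewrite sum-map-swap f xs ys =
  sym (sum-map-+ (f x) (λ y → sum (map (λ x → f x y) xs)) ys)

module _ {n : ℕ} where

  ∑∑ : (Fin n → Fin n → ℕ) → ℕ
  ∑∑ f = sum (map (λ i → sum (map (f i) (allFin n))) (allFin n))

  ∑∑-cong : ∀ {f g} → (∀ i j → f i j ≡ g i j) → ∑∑ f ≡ ∑∑ g
  ∑∑-cong f≡g =
    cong sum (ListP.map-cong (λ i → cong sum (ListP.map-cong (f≡g i) (allFin n))) (allFin n))

  ∑∑-+ : ∀ f g → ∑∑ (λ i j → f i j ℕ.+ g i j) ≡ ∑∑ f ℕ.+ ∑∑ g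
  ∑∑-+ f g = trans (cong sum (ListP.map-cong (λ i → sum-map-+ (f i) (g i) (allFin n)) (allFin n)))
                   (sum-map-+ (λ i → sum (map (f i) (allFin n)))
                              (λ i → sum (map (g i) (allFin n))) (allFin n))

  ∑∑-mono-< : ∀ {f g} → (∀ i j → f i j ℕ.≤ g i j) → ∀ a b → f a b ℕ.< g a b → ∑∑ f ℕ.< ∑∑ g
  ∑∑-mono-< f≤g a b f<g =
    sum-map-mono-< (λ i → sum-map-mono-≤ (f≤g i) (allFin n)) (∈-allFin a)
                   (sum-map-mono-< (f≤g a) (∈-allFin b) f<g)

∣x∣≡pos-x+pos-[-x] : ∀ x → ∣ x ∣ ≡ pos x ℕ.+ pos (- x)
∣x∣≡pos-x+pos-[-x] (+ ℕ.zero) = refl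
∣x∣≡pos-x+pos-[-x] (+ suc m)  = sym (ℕP.+-identityʳ (suc m))
∣x∣≡pos-x+pos-[-x] -[1+ m ]   = refl

-- Each arrow is counted once by q_{ij} and once by q_{ji}.
∑∑∣q∣≡2*arrows : ∀ {n} (q : Mat n) → IsQuiver q → ∑∑ (λ i j → ∣ q i j ∣) ≡ arrows q ℕ.+ arrows q
∑∑∣q∣≡2*arrows {n} q skew = begin
  ∑∑ (λ i j → ∣ q i j ∣)                    ≡⟨ ∑∑-cong (λ i j → ∣q∣≡q⁺+q⁻ i j) ⟩
  ∑∑ (λ i j → pos (q i j) ℕ.+ pos (q j i))  ≡⟨ ∑∑-+ (λ i j → pos (q i j)) (λ i j → pos (q j i)) ⟩
  arrows q ℕ.+ ∑∑ (λ i j → pos (q j i))     ≡⟨ cong (arrows q ℕ.+_) (sym (sum-map-swap q⁺ (allFin n) (allFin n))) ⟩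
  arrows q ℕ.+ arrows q                     ∎
  where
  open ≡-Reasoning
  q⁺ : Fin n → Fin n → ℕ
  q⁺ i j = pos (q i j)
  ∣q∣≡q⁺+q⁻ : ∀ i j → ∣ q i j ∣ ≡ pos (q i j) ℕ.+ pos (q j i)
  ∣q∣≡q⁺+q⁻ i j =
    trans (∣x∣≡pos-x+pos-[-x] (q i j)) (cong (λ w → pos (q i j) ℕ.+ pos w) (sym (skew j i)))

m+m<n+n⇒m<n : ∀ {m n} → m ℕ.+ m ℕ.< n ℕ.+ n → m ℕ.< n
m+m<n+n⇒m<n h = ℕP.≰⇒> (λ n≤m → ℕP.<⇒≱ h (ℕP.+-mono-≤ n≤m n≤m))

arrows-mono-< : ∀ {n} {q p : Mat n} → IsQuiver q → IsQuiver p →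
                (∀ i j → ∣ q i j ∣ ℕ.≤ ∣ p i j ∣) → ∀ a b → ∣ q a b ∣ ℕ.< ∣ p a b ∣ →
                arrows q ℕ.< arrows p
arrows-mono-< {q = q} {p} skew-q skew-p ∣q∣≤∣p∣ a b ∣q∣<∣p∣ =
  m+m<n+n⇒m<n (subst₂ ℕ._<_ (∑∑∣q∣≡2*arrows q skew-q) (∑∑∣q∣≡2*arrows p skew-p)
                            (∑∑-mono-< ∣q∣≤∣p∣ a b ∣q∣<∣p∣))

IsKey-sym : ∀ {n} {q : Mat n} {k k'} → IsKey q k k' → IsKey q k' k
IsKey-sym (k≢k' , ab , ac , ab' , ac' , sides) =
  (λ e → k≢k' (sym e)) , ab' , ac' , ab , ac ,
  λ i i≢k' i≢k → Sum.map Product.swap Product.swap (sides i i≢k i≢k')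

Between-sym : ∀ {n} {q : Mat n} {k k' i} → Between q k k' i ⇔ Between q k' k i
Between-sym = mk⇔ Sum.swap Sum.swap

module Key {n} (q : Mat n) (k k' : Fin n) (skew : IsQuiver q) (key : IsKey q k k') where
  open Quiver q skew
  open Mutation q using (μ-row; μ-col; μ-no-return; μ-unchanged; μ-skew)
  module μₖ = MutationAt q skew k

  P : Mat n
  P = μ k q

  module P = Quiver P (μ-skew skew k)

  k≢k' : k ≢ k'
  k≢k' = proj₁ key

  k'≢k : k' ≢ k
  k'≢k e = k≢k' (sym e)

  abundant-k : Abundant q (without k)
  abundant-k = proj₁ (proj₂ key)

  abundant-k' : Abundant q (without k')
  abundant-k' = proj₁ (proj₂ (proj₂ (proj₂ key)))

  acyclic-k' : Acyclic q (without k')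
  acyclic-k' = proj₁ (proj₂ (proj₂ (proj₂ (proj₂ key))))

  sides : ∀ i → i ≢ k → i ≢ k' → (Out q k i × Out q k' i) ⊎ (In q k i × In q k' i)
  sides = proj₂ (proj₂ (proj₂ (proj₂ (proj₂ key))))

  Out-k⇒Out-k' : ∀ {i} → i ≢ k → i ≢ k' → Out q k i → Out q k' i
  Out-k⇒Out-k' {i} i≢k i≢k' o with sides i i≢k i≢k'
  ... | inj₁ (_ , o') = o'
  ... | inj₂ (ι , _)  = ⊥-elim (no-2-cycle o ι)

  In-k⇒In-k' : ∀ {i} → i ≢ k → i ≢ k' → In q k i → In q k' i
  In-k⇒In-k' {i} i≢k i≢k' ι with sides i i≢k i≢k'
  ... | inj₁ (o , _)  = ⊥-elim (no-2-cycle ι o)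
  ... | inj₂ (_ , ι') = ι'

  Out-k'⇒Out-k : ∀ {i} → i ≢ k → i ≢ k' → Out q k' i → Out q k i
  Out-k'⇒Out-k {i} i≢k i≢k' o' with sides i i≢k i≢k'
  ... | inj₁ (o , _)  = o
  ... | inj₂ (_ , ι') = ⊥-elim (no-2-cycle o' ι')

  In-k'⇒In-k : ∀ {i} → i ≢ k → i ≢ k' → In q k' i → In q k i
  In-k'⇒In-k {i} i≢k i≢k' ι' with sides i i≢k i≢k'
  ... | inj₁ (_ , o') = ⊥-elim (no-2-cycle ι' o')
  ... | inj₂ (ι , _)  = ι

  abundant-except-key : ∀ {a b} → a ≢ b → ¬ (a ≡ k × b ≡ k') → ¬ (a ≡ k' × b ≡ k) →
                        2 ℕ.≤ ∣ q a b ∣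
  abundant-except-key {a} {b} a≢b ¬kk' ¬k'k with toSum (a ≟ k) | toSum (b ≟ k)
  ... | inj₂ a≢k  | inj₂ b≢k  = abundant-k a b a≢k b≢k a≢b
  ... | inj₁ refl | _         = abundant-k' k b k≢k' (λ b≡k' → ¬kk' (refl , b≡k')) a≢b
  ... | inj₂ _    | inj₁ refl = abundant-k' a k (λ a≡k' → ¬k'k (a≡k' , refl)) k≢k' a≢b

  -- Through k' by the side condition, otherwise because Q \ {k'} is abundant and acyclic.
  key-transitive : ∀ {a b} → a ≢ k → b ≢ k → In q k a → Out q k b → Pos (q a b)
  key-transitive {a} {b} a≢k b≢k ιa ob with toSum (a ≟ k') | toSum (b ≟ k')
  ... | inj₁ refl | inj₁ refl = ⊥-elim (no-2-cycle ιa ob)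
  ... | inj₁ refl | inj₂ b≢k' = Out-k⇒Out-k' b≢k b≢k' ob
  ... | inj₂ a≢k' | inj₁ refl = In-k⇒In-k' a≢k a≢k' ιa
  ... | inj₂ a≢k' | inj₂ b≢k'
    with abundant⇒arrow (abundant-k' a b a≢k' b≢k' (λ { refl → no-2-cycle ιa ob }))
  ...   | inj₁ ab = ab
  ...   | inj₂ ba =
    ⊥-elim (acyclic-k' a ((a≢k' , k≢k' , ιa) ∷ (k≢k' , b≢k' , ob) ∷ edge (b≢k' , a≢k' , ba)))

  μₖ-unchanged : ∀ {a b} → a ≢ k → b ≢ k → ¬ Pos (q a b) → ¬ Pos (q b a) → P a b ≡ q a b
  μₖ-unchanged a≢k b≢k ¬ab ¬ba = μ-unchanged a≢k b≢k
    (λ (ιa , ob) → ¬ab (key-transitive a≢k b≢k ιa ob))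
    (λ (ιb , oa) → ¬ba (key-transitive b≢k a≢k ιb oa))

  q≤μₖ : ∀ {a b} → a ≢ k → b ≢ k → ¬ Pos (q b a) → q a b ≤ℤ P a b
  q≤μₖ {a} {b} a≢k b≢k ¬ba =
    subst (q a b ≤ℤ_) (sym (μ-no-return a≢k b≢k (λ (ιb , oa) → ¬ba (key-transitive b≢k a≢k ιb oa))))
          (x≤x+[]⁺*[]⁺ (q a b) (q a k) (q k b))

  μₖ-preserves-arrow : ∀ {a b} → a ≢ k → b ≢ k → Pos (q a b) → Pos (P a b)
  μₖ-preserves-arrow a≢k b≢k ab = ℤP.<-≤-trans ab (q≤μₖ a≢k b≢k (no-2-cycle ab))

  μₖ-reflects-arrow : ∀ {a b} → a ≢ k → b ≢ k → Pos (P a b) → Pos (q a b)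
  μₖ-reflects-arrow {a} {b} a≢k b≢k p with + 0 ℤP.<? q a b | + 0 ℤP.<? q b a
  ... | yes ab  | _       = ab
  ... | no _    | yes ba  = ⊥-elim (P.no-2-cycle {a} {b} p (μₖ-preserves-arrow b≢k a≢k ba))
  ... | no ¬ab  | no ¬ba  = subst Pos (μₖ-unchanged a≢k b≢k ¬ab ¬ba) p

  ∣q∣≤∣μₖ∣ : ∀ a b → ∣ q a b ∣ ℕ.≤ ∣ P a b ∣
  ∣q∣≤∣μₖ∣ a b with toSum (a ≟ k) | toSum (b ≟ k)
  ... | inj₁ refl | _         rewrite μ-row a b | ℤP.∣-i∣≡∣i∣ (q a b) = ℕP.≤-refl
  ... | inj₂ _    | inj₁ refl rewrite μ-col b a | ℤP.∣-i∣≡∣i∣ (q a b) = ℕP.≤-refl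
  ... | inj₂ a≢k  | inj₂ b≢k  with trichotomy a b
  ...   | inj₁ ab        = ∣∣-mono-≤ (ℤP.<⇒≤ ab) (q≤μₖ a≢k b≢k (no-2-cycle ab))
  ...   | inj₂ (inj₁ e)  rewrite e = z≤n
  ...   | inj₂ (inj₂ ba) rewrite ∣∣-sym a b | P.∣∣-sym a b =
    ∣∣-mono-≤ (ℤP.<⇒≤ ba) (q≤μₖ b≢k a≢k (no-2-cycle ba))

  abundant-μₖ : Abundant P (without k)
  abundant-μₖ a b a≢k b≢k a≢b = ℕP.≤-trans (abundant-k a b a≢k b≢k a≢b) (∣q∣≤∣μₖ∣ a b)

  acyclic-μₖ : Acyclic P (without k)
  acyclic-μₖ = Acyclic-map (λ (a≢k , b≢k , p) → a≢k , b≢k , μₖ-reflects-arrow a≢k b≢k p)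
                           (proj₁ (proj₂ (proj₂ key)))

  abundant-μₖ-except-key : ∀ {a b} → a ≢ b → ¬ (a ≡ k × b ≡ k') → ¬ (a ≡ k' × b ≡ k) →
                           2 ℕ.≤ ∣ P a b ∣
  abundant-μₖ-except-key a≢b ¬kk' ¬k'k =
    ℕP.≤-trans (abundant-except-key a≢b ¬kk' ¬k'k) (∣q∣≤∣μₖ∣ _ _)

  Between-μₖ : ∀ i → Between P k k' i ⇔ (i ≢ k × i ≢ k')
  Between-μₖ i = mk⇔ to from
    where
    to : Between P k k' i → i ≢ k × i ≢ k'
    to (inj₁ (o , ι')) = (λ e → P.arrow⇒≢ o (sym e)) , P.arrow⇒≢ ι'
    to (inj₂ (o' , ι)) = P.arrow⇒≢ ι , (λ e → P.arrow⇒≢ o' (sym e))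

    from : i ≢ k × i ≢ k' → Between P k k' i
    from (i≢k , i≢k') with sides i i≢k i≢k'
    ... | inj₁ (o , o') = inj₂ (μₖ-preserves-arrow k'≢k i≢k o' , subst Pos (sym (μₖ.μ-col≡row i)) o)
    ... | inj₂ (ι , ι') = inj₁ (subst Pos (sym (μₖ.μ-row≡col i)) ι , μₖ-preserves-arrow i≢k k'≢k ι')

  ThroughK : Set
  ThroughK = ∃ λ y → ∃ λ x → y ≢ k' × x ≢ k' × In q k y × Out q k x

  through-k : ¬ IsSource q k → ¬ IsSink q k → ¬ IsSource q k' → ¬ IsSink q k' → ThroughK
  through-k ¬src ¬snk ¬src' ¬snk'
    with trichotomy k k' | ¬Source⇒In q k ¬src | ¬Sink⇒Out q k ¬snk
       | ¬Source⇒In q k' ¬src' | ¬Sink⇒Out q k' ¬snk'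
  ... | inj₁ kk' | y , ιy | _ | _ | x , o'x =
    y , x , (λ { refl → no-2-cycle kk' ιy }) , (λ { refl → no-loop o'x }) , ιy ,
    Out-k'⇒Out-k (λ { refl → no-2-cycle kk' o'x }) (λ { refl → no-loop o'x }) o'x
  ... | inj₂ (inj₁ kk'≡0) | y , ιy | x , ox | _ | _ =
    y , x , (λ { refl → Pos⇒≢0 ιy (trans (skew k' k) (cong -_ kk'≡0)) }) ,
    (λ { refl → Pos⇒≢0 ox kk'≡0 }) , ιy , ox
  ... | inj₂ (inj₂ k'k) | _ | x , ox | y , ι'y | _ =
    y , x , (λ { refl → no-loop ι'y }) , (λ { refl → no-2-cycle k'k ox }) ,
    In-k'⇒In-k (λ { refl → no-2-cycle k'k ι'y }) (λ { refl → no-loop ι'y }) ι'y , ox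

  2≤-at-k : ∀ {a b} → a ≢ k' → b ≢ k' → Pos (q a b) → + 2 ≤ℤ q a b
  2≤-at-k a≢k' b≢k' ab = 2≤∣x∣⇒Pos⇒2≤x (abundant-k' _ _ a≢k' b≢k' (arrow⇒≢ ab)) ab

  μₖ-fork : ThroughK → IsFork P (without k') k
  μₖ-fork (y , x , y≢k' , x≢k' , ιy , ox) = μₖ.μ-fork k≢k'
    (λ x x≢k' x≢k → abundant-k' k x k≢k' x≢k' (λ e → x≢k (sym e)))
    (λ a b a≢k' b≢k' a≢b _ → abundant-k' a b a≢k' b≢k' a≢b)
    (λ y x y≢k' x≢k' ιy ox →
      fork-ineq (ℤP.<⇒≤ (key-transitive (μₖ.In≢ ιy) (μₖ.Out≢ ox) ιy ox))
                (2≤-at-k y≢k' k≢k' ιy) (2≤-at-k k≢k' x≢k' ox))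
    (Acyclic-mono proj₁ acyclic-k') (Acyclic-mono proj₁ acyclic-k')
    (y , x , y≢k' , x≢k' , ιy , ox)

  μₖ-increases-arrows : ThroughK → arrows q ℕ.< arrows P
  μₖ-increases-arrows (y , x , _ , _ , ιy , ox) =
    arrows-mono-< skew (μ-skew skew k) ∣q∣≤∣μₖ∣ y x
      (subst (λ w → ∣ q y x ∣ ℕ.< ∣ w ∣) (sym (μₖ.μ-through ιy ox))
        (∣x∣<∣x+y*z∣ (ℤP.<⇒≤ (key-transitive (μₖ.In≢ ιy) (μₖ.Out≢ ox) ιy ox)) ιy ox))

  module AtVertex (r : Fin n) (r≢k : r ≢ k) (r≢k' : r ≢ k') where
    module μᵣ = MutationAt P (μ-skew skew k) r

    key-separated-by-r : Between P k k' r
    key-separated-by-r = Equivalence.from (Between-μₖ r) (r≢k , r≢k')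

    same-side⇒¬key : ∀ {a b} → (In P r a × In P r b) ⊎ (Out P r a × Out P r b) → ¬ (a ≡ k × b ≡ k')
    same-side⇒¬key s (refl , refl) with key-separated-by-r | s
    ... | inj₁ (_  , rk') | inj₁ (_ , k'r) = P.no-2-cycle {r} {k'} rk' k'r
    ... | inj₁ (kr , _)   | inj₂ (rk , _)  = P.no-2-cycle {k} {r} kr rk
    ... | inj₂ (_  , rk)  | inj₁ (kr , _)  = P.no-2-cycle {r} {k} rk kr
    ... | inj₂ (k'r , _)  | inj₂ (_ , rk') = P.no-2-cycle {k'} {r} k'r rk'

    abundant-at-r : ∀ x → ⊤ → x ≢ r → 2 ℕ.≤ ∣ P r x ∣
    abundant-at-r x _ x≢r =
      abundant-μₖ-except-key (λ e → x≢r (sym e)) (λ (e , _) → r≢k e) (λ (e , _) → r≢k' e)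

    abundant-sides : ∀ a b → ⊤ → ⊤ → a ≢ b → (In P r a × In P r b) ⊎ (Out P r a × Out P r b) →
                     2 ℕ.≤ ∣ P a b ∣
    abundant-sides a b _ _ a≢b s = abundant-μₖ-except-key a≢b (same-side⇒¬key s)
      (λ (a≡k' , b≡k) → same-side⇒¬key (Sum.map Product.swap Product.swap s) (b≡k , a≡k'))

    2≤Out : ∀ {x} → Out P r x → + 2 ≤ℤ P r x
    2≤Out o = 2≤∣x∣⇒Pos⇒2≤x (abundant-at-r _ tt (λ e → P.arrow⇒≢ o (sym e))) o

    2≤In : ∀ {y} → In P r y → + 2 ≤ℤ P y r
    2≤In {y} ι = 2≤∣x∣⇒Pos⇒2≤x (subst (2 ℕ.≤_) (P.∣∣-sym r y) (abundant-at-r y tt (P.arrow⇒≢ ι))) ι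

    dominates-from-k : ∀ {x} → x ≢ k → In q k r → Out q k x →
      (P r x <ℤ P k x + P k r * P r x) × (P k r <ℤ P k x + P k r * P r x)
    dominates-from-k {x} x≢k ιr okx
      rewrite μ-row k x | μₖ.μ-row≡col r | μₖ.μ-through ιr okx
            | ℤP.*-comm (q r k) (q k x) | ℤP.*-comm (q r k) (q r x + q k x * q r k) =
      Product.swap (fork-ineq-reversed okx (2≤-at-k r≢k' k≢k' ιr)
                                           (ℤP.<⇒≤ (key-transitive r≢k x≢k ιr okx)))

    dominates-into-k : ∀ {y} → y ≢ k → In q k y → Out q k r →
      (P r k <ℤ P y k + P y r * P r k) × (P y r <ℤ P y k + P y r * P r k)
    dominates-into-k {y} y≢k ιy or rewrite μ-col k y | μₖ.μ-col≡row r | μₖ.μ-through ιy or =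
      fork-ineq-reversed ιy (2≤-at-k k≢k' r≢k' or) (ℤP.<⇒≤ (key-transitive y≢k r≢k ιy or))

    -- A triangle y → r → x → y of P has to pass through k, where μ_k reversed the arrow x → y.
    dominates : ∀ y x → ⊤ → ⊤ → In P r y → Out P r x →
      (P r x <ℤ P y x + P y r * P r x) × (P y r <ℤ P y x + P y r * P r x)
    dominates y x _ _ yr rx with P.trichotomy y x
    ... | inj₁ yx          = fork-ineq {P y x} (ℤP.<⇒≤ yx) (2≤In {y} yr) (2≤Out {x} rx)
    ... | inj₂ (inj₁ yx≡0) = fork-ineq {P y x} (ℤP.≤-reflexive (sym yx≡0)) (2≤In {y} yr) (2≤Out {x} rx)
    ... | inj₂ (inj₂ xy) with toSum (y ≟ k) | toSum (x ≟ k)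
    ...   | inj₁ refl | inj₁ refl = ⊥-elim (P.no-loop {y} xy)
    ...   | inj₁ refl | inj₂ x≢k  = dominates-from-k x≢k (μₖ.μ-Out⇒In yr) (μₖ.μ-In⇒Out xy)
    ...   | inj₂ y≢k  | inj₁ refl = dominates-into-k y≢k (μₖ.μ-Out⇒In xy) (μₖ.μ-In⇒Out rx)
    ...   | inj₂ y≢k  | inj₂ x≢k  =
      ⊥-elim (acyclic-μₖ y ((y≢k , r≢k , yr) ∷ (r≢k , x≢k , rx) ∷ edge (x≢k , y≢k , xy)))

    k-source-of-In : In q k r → ∀ x → ⊤ × In P r x → ¬ Pos (P x k)
    k-source-of-In ιr x (_ , xr) xk with toSum (x ≟ k)
    ... | inj₁ refl = P.no-loop {x} xk
    ... | inj₂ x≢k  = P.no-2-cycle {x} {r} xr (μₖ-preserves-arrow r≢k x≢k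
                        (key-transitive r≢k x≢k ιr (μₖ.μ-In⇒Out xk)))

    k-sink-of-Out : Out q k r → ∀ x → ⊤ × Out P r x → ¬ Pos (P k x)
    k-sink-of-Out or x (_ , rx) kx with toSum (x ≟ k)
    ... | inj₁ refl = P.no-loop {x} kx
    ... | inj₂ x≢k  = P.no-2-cycle {r} {x} rx (μₖ-preserves-arrow x≢k r≢k
                        (key-transitive x≢k r≢k (μₖ.μ-Out⇒In kx) or))

    acyclic-sides : Acyclic P (λ i → ⊤ × In P r i) × Acyclic P (λ i → ⊤ × Out P r i)
    acyclic-sides with key-separated-by-r
    ... | inj₁ (kr , _) =
      Acyclic-adjoin-source k (λ _ _ x≢k → x≢k) (k-source-of-In (μₖ.μ-Out⇒In kr)) acyclic-μₖ ,
      Acyclic-mono (λ (_ , rx) x≡k → P.no-2-cycle {k} {r} kr (subst (λ z → Pos (P r z)) x≡k rx))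
                   acyclic-μₖ
    ... | inj₂ (_ , rk) =
      Acyclic-mono (λ (_ , xr) x≡k → P.no-2-cycle {r} {k} rk (subst (λ z → Pos (P z r)) x≡k xr))
                   acyclic-μₖ ,
      Acyclic-adjoin-sink k (λ _ _ x≢k → x≢k) (k-sink-of-Out (μₖ.μ-In⇒Out rk)) acyclic-μₖ

    through-r : ∃ λ y → ∃ λ x → ⊤ × ⊤ × In P r y × Out P r x
    through-r with key-separated-by-r
    ... | inj₁ (kr , rk')  = k  , k' , tt , tt , kr , rk'
    ... | inj₂ (k'r , rk)  = k' , k  , tt , tt , k'r , rk

    μᵣ-fork : IsFork (μ r P) allV r
    μᵣ-fork = μᵣ.μ-fork tt abundant-at-r abundant-sides dominates
                        (proj₁ acyclic-sides) (proj₂ acyclic-sides) through-r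

lemma4p11 : ∀ {n} (q : Mat n) (k k' : Fin n)
    → IsQuiver q
    → IsKey q k k'
    → ¬ IsSource q k → ¬ IsSink q k
    → ¬ IsSource q k' → ¬ IsSink q k'
    → (arrows q < arrows (μ k q) × arrows q < arrows (μ k' q))
      × (IsFork (μ k q) (without k') k × IsFork (μ k' q) (without k) k')
      × (Abundant (μ k q) (without k) × Acyclic (μ k q) (without k)
         × Abundant (μ k' q) (without k') × Acyclic (μ k' q) (without k'))
      × (∀ i → (Between (μ k q) k k' i ⇔ (i ≢ k × i ≢ k'))
               × (Between (μ k' q) k k' i ⇔ (i ≢ k × i ≢ k')))
      × (∀ r → r ≢ k → r ≢ k'
           → IsFork (μ r (μ k q)) allV r × IsFork (μ r (μ k' q)) allV r)
lemma4p11 q k k' skew key ¬src ¬snk ¬src' ¬snk' =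
  (K.μₖ-increases-arrows through , K'.μₖ-increases-arrows through') ,
  (K.μₖ-fork through , K'.μₖ-fork through') ,
  (K.abundant-μₖ , K.acyclic-μₖ , K'.abundant-μₖ , K'.acyclic-μₖ) ,
  (λ i → K.Between-μₖ i , Between-μₖ' i) ,
  (λ r r≢k r≢k' → K.AtVertex.μᵣ-fork r r≢k r≢k' , K'.AtVertex.μᵣ-fork r r≢k' r≢k)
  where
  module K  = Key q k k' skew key
  module K' = Key q k' k skew (IsKey-sym key)
  through : K.ThroughK
  through = K.through-k ¬src ¬snk ¬src' ¬snk'
  through' : K'.ThroughK
  through' = K'.through-k ¬src' ¬snk' ¬src ¬snk
  Between-μₖ' : ∀ i → Between (μ k' q) k k' i ⇔ (i ≢ k × i ≢ k')
  Between-μₖ' i = ⇔.trans (Between-sym {q = μ k' q} {k = k} {k' = k'} {i = i})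
                          (⇔.trans (K'.Between-μₖ i) (mk⇔ Product.swap Product.swap))
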